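{- Let $n$ and $k$ be integers with $k \ge 2$ and $n \ge 2k$, and let $x,y,z \in [n]=\{1,\dots,n\}$ be mutually distinct. Define $$S_{x,y,z}' = V(J_{n,k}) \setminus \{\{x,z\} \cup T,\ \{y,z\} \cup T \;:\; T \subset [n] \setminus \{x,y,z\},\ |T|=k-2\}.$$ Then $S_{x,y,z}'$ is not an edge resolving set of the Johnson graph $J_{n,k}$.
   Context: The Johnson graph $J_{n,k}$ has as vertices all $k$-element subsets of $[n]$, two of them $A,B$ being adjacent iff $|A\cap B|=k-1$; the graph distance is $d(A,B)=k-|A\cap B|$. For an edge $e=uv$ and a vertex $w$, $d(e,w)=\min\{d(u,w),d(v,w)\}$. A set $N\subseteq V(G)$ is an edge resolving set of a connected graph $G$ if for every two distinct edges $e_1,e_2$ of $G$ there is $w\in N$ with $d(e_1,w)\ne d(e_2,w)$. The paper considers Johnson graphs only with $n\ge 2k$. -}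

module Defs where

open import Data.Nat using (ℕ; _∸_)
open import Data.Fin using (Fin)
open import Data.Fin.Subset using (Subset; _∩_; _∪_; ∣_∣; _∈_; _∉_; ⁅_⁆)
open import Data.Product using (Σ; ∃; ∃-syntax; _×_; _,_; proj₁)
open import Data.Sum using (_⊎_)
open import Relation.Nullary using (¬_)
open import Relation.Binary.PropositionalEquality using (_≡_; _≢_)
open import Data.Nat using (_⊓_)

JVertex : ℕ → ℕ → Set
JVertex n k = Σ (Subset n) (λ A → ∣ A ∣ ≡ k)

jdist : ∀ {n k} → JVertex n k → JVertex n k → ℕ
jdist {k = k} (A , _) (B , _) = k ∸ ∣ A ∩ B ∣

JAdj : ∀ {n k} → JVertex n k → JVertex n k → Set
JAdj {k = k} (A , _) (B , _) = ∣ A ∩ B ∣ ≡ k ∸ 1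

JEdge : ℕ → ℕ → Set
JEdge n k = Σ (JVertex n k × JVertex n k) (λ { (u , v) → JAdj u v })

SameEdge : ∀ {n k} → JEdge n k → JEdge n k → Set
SameEdge (((u , _) , (v , _)) , _) (((u' , _) , (v' , _)) , _) =
  (u ≡ u' × v ≡ v') ⊎ (u ≡ v' × v ≡ u')

edist : ∀ {n k} → JEdge n k → JVertex n k → ℕ
edist ((u , v) , _) w = jdist u w ⊓ jdist v w

IsEdgeResolving : ∀ {n k} → (JVertex n k → Set) → Set
IsEdgeResolving {n} {k} N =
  (e₁ e₂ : JEdge n k) → ¬ SameEdge e₁ e₂ →
  ∃[ w ] (N w × edist e₁ w ≢ edist e₂ w)

InS' : ∀ {n k} → Fin n → Fin n → Fin n → JVertex n k → Set
InS' {n} {k} x y z (A , _) =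
  ¬ (∃[ T ] (x ∉ T × y ∉ T × z ∉ T × ∣ T ∣ ≡ k ∸ 2 ×
             (A ≡ (⁅ x ⁆ ∪ ⁅ z ⁆) ∪ T ⊎ A ≡ (⁅ y ⁆ ∪ ⁅ z ⁆) ∪ T)))

{-# OPTIONS --safe #-}
module Submission where

-- Pick a (k-2)-set T avoiding x, y, z, and consider the edges e₁ = {A, B} and e₂ = {A, C}
-- with A = {x,y} ∪ T, B = {x,z} ∪ T, C = {y,z} ∪ T.  The distance from an edge to W is
-- k minus the larger of its endpoints' intersections with W.  If z ∉ W, the common endpoint A
-- meets W at least as much as B and C, so both distances are d(A, W).  If z ∈ W, then W ∈ S'
-- forces x ∈ W ⇔ y ∈ W, so B and C meet W equally.  Either way S' does not separate e₁, e₂.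

open import Defs
import Algebra.Properties.CommutativeSemigroup as CommSemigroupProperties
open import Algebra.Bundles using (CommutativeMonoid)
open import Data.Fin using (Fin; zero; suc)
open import Data.Fin.Subset
open import Data.Fin.Subset.Properties
open import Data.Nat using (ℕ; zero; suc; _≤_; _*_; _+_; _∸_; _⊓_; s≤s)
open import Data.Nat.Properties
  using (suc-injective; ≤-trans; m≤m+n; m+n≤o⇒m≤o∸n; m≤n⇒m⊓n≡m; ∸-monoʳ-≤; module ≤-Reasoning)
open import Data.Nat.Tactic.RingSolver using (solve-∀)
open import Data.Product using (∃-syntax; _×_; _,_; proj₁; proj₂)
open import Data.Sum using (inj₁; inj₂; [_,_]′) renaming (swap to ⊎-swap)
open import Data.Vec using (_∷_; here; there)
open import Function using (_∘_; id)
open import Relation.Nullary using (¬_; yes; no; contradiction)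
open import Relation.Nullary.Decidable using (decidable-stable)
open import Relation.Binary.PropositionalEquality
  using (_≡_; _≢_; sym; trans; cong; cong₂; subst; module ≡-Reasoning)

private
  variable
    n m : ℕ
    x y : Fin n
    p q r : Subset n

x≢y∧x∉p⇒x∉⁅y⁆∪p : x ≢ y → x ∉ p → x ∉ ⁅ y ⁆ ∪ p
x≢y∧x∉p⇒x∉⁅y⁆∪p {y = y} {p = p} x≢y x∉p x∈ =
  [ x≢y ∘ x∈⁅y⁆⇒x≡y y , x∉p ]′ (x∈p∪q⁻ ⁅ y ⁆ p x∈)

x∈p⇒⁅x⁆⊆p : x ∈ p → ⁅ x ⁆ ⊆ p
x∈p⇒⁅x⁆⊆p {x = x} x∈p i∈⁅x⁆ = subst (_∈ _) (sym (x∈⁅y⁆⇒x≡y x i∈⁅x⁆)) x∈p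

⁅x⁆∪[⁅y⁆∪p]≡⁅y⁆∪[⁅x⁆∪p] : ∀ (x y : Fin n) p → ⁅ x ⁆ ∪ (⁅ y ⁆ ∪ p) ≡ ⁅ y ⁆ ∪ (⁅ x ⁆ ∪ p)
⁅x⁆∪[⁅y⁆∪p]≡⁅y⁆∪[⁅x⁆∪p] {n} x y p = CommSemigroupProperties.x∙yz≈y∙xz
  (CommutativeMonoid.commutativeSemigroup (∪-commutativeMonoid n)) ⁅ x ⁆ ⁅ y ⁆ p

p⊆q⇒p∪q≡q : p ⊆ q → p ∪ q ≡ q
p⊆q⇒p∪q≡q {p = p} {q = q} p⊆q = ⊆-antisym (λ x∈p∪q → [ p⊆q , id ]′ (x∈p∪q⁻ p q x∈p∪q)) (q⊆p∪q p q)

p⊆q⇒p∪[q∩∁p]≡q : p ⊆ q → p ∪ (q ∩ ∁ p) ≡ q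
p⊆q⇒p∪[q∩∁p]≡q {p = p} {q = q} p⊆q = begin
  p ∪ (q ∩ ∁ p)       ≡⟨ ∪-distribˡ-∩ p q (∁ p) ⟩
  (p ∪ q) ∩ (p ∪ ∁ p) ≡⟨ cong ((p ∪ q) ∩_) (p∪∁p≡⊤ p) ⟩
  (p ∪ q) ∩ ⊤         ≡⟨ ∩-identityʳ (p ∪ q) ⟩
  p ∪ q               ≡⟨ p⊆q⇒p∪q≡q p⊆q ⟩
  q                   ∎
  where open ≡-Reasoning

x∉p⇒⁅x⁆∩p≡⊥ : x ∉ p → ⁅ x ⁆ ∩ p ≡ ⊥
x∉p⇒⁅x⁆∩p≡⊥ {x = zero}  {p = outside ∷ p} _   = cong (outside ∷_) (∩-zeroˡ p)
x∉p⇒⁅x⁆∩p≡⊥ {x = zero}  {p = inside ∷ p} x∉p = contradiction here x∉p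
x∉p⇒⁅x⁆∩p≡⊥ {x = suc x} {p = s ∷ p}      x∉p = cong (outside ∷_) (x∉p⇒⁅x⁆∩p≡⊥ (x∉p ∘ there))

x∈p⇒⁅x⁆∩p≡⁅x⁆ : x ∈ p → ⁅ x ⁆ ∩ p ≡ ⁅ x ⁆
x∈p⇒⁅x⁆∩p≡⁅x⁆ {x = zero}  {p = inside ∷ p} here        = cong (inside ∷_) (∩-zeroˡ p)
x∈p⇒⁅x⁆∩p≡⁅x⁆ {x = suc x} {p = s ∷ p}      (there x∈p) = cong (outside ∷_) (x∈p⇒⁅x⁆∩p≡⁅x⁆ x∈p)

∣⁅x⁆∪p∣≡1+∣p∣ : x ∉ p → ∣ ⁅ x ⁆ ∪ p ∣ ≡ suc ∣ p ∣
∣⁅x⁆∪p∣≡1+∣p∣ {x = zero}  {p = outside ∷ p} _   = cong (suc ∘ ∣_∣) (∪-identityˡ p)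
∣⁅x⁆∪p∣≡1+∣p∣ {x = zero}  {p = inside ∷ p} x∉p = contradiction here x∉p
∣⁅x⁆∪p∣≡1+∣p∣ {x = suc x} {p = outside ∷ p} x∉p = ∣⁅x⁆∪p∣≡1+∣p∣ (x∉p ∘ there)
∣⁅x⁆∪p∣≡1+∣p∣ {x = suc x} {p = inside ∷ p} x∉p = cong suc (∣⁅x⁆∪p∣≡1+∣p∣ (x∉p ∘ there))

∣[⁅x⁆∪p]∩q∣≡∣p∩q∣ : x ∉ q → ∣ (⁅ x ⁆ ∪ p) ∩ q ∣ ≡ ∣ p ∩ q ∣
∣[⁅x⁆∪p]∩q∣≡∣p∩q∣ {x = x} {q = q} {p = p} x∉q = cong ∣_∣ (begin
  (⁅ x ⁆ ∪ p) ∩ q       ≡⟨ ∩-distribʳ-∪ q ⁅ x ⁆ p ⟩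
  (⁅ x ⁆ ∩ q) ∪ (p ∩ q) ≡⟨ cong (_∪ (p ∩ q)) (x∉p⇒⁅x⁆∩p≡⊥ x∉q) ⟩
  ⊥ ∪ (p ∩ q)           ≡⟨ ∪-identityˡ (p ∩ q) ⟩
  p ∩ q                 ∎)
  where open ≡-Reasoning

∣[⁅x⁆∪p]∩q∣≡1+∣p∩q∣ : x ∉ p → x ∈ q → ∣ (⁅ x ⁆ ∪ p) ∩ q ∣ ≡ suc ∣ p ∩ q ∣
∣[⁅x⁆∪p]∩q∣≡1+∣p∩q∣ {x = x} {p = p} {q = q} x∉p x∈q = begin
  ∣ (⁅ x ⁆ ∪ p) ∩ q ∣       ≡⟨ cong ∣_∣ (∩-distribʳ-∪ q ⁅ x ⁆ p) ⟩
  ∣ (⁅ x ⁆ ∩ q) ∪ (p ∩ q) ∣ ≡⟨ cong (λ s → ∣ s ∪ (p ∩ q) ∣) (x∈p⇒⁅x⁆∩p≡⁅x⁆ x∈q) ⟩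
  ∣ ⁅ x ⁆ ∪ (p ∩ q) ∣       ≡⟨ ∣⁅x⁆∪p∣≡1+∣p∣ (x∉p ∘ proj₁ ∘ x∈p∩q⁻ p q) ⟩
  suc ∣ p ∩ q ∣             ∎
  where open ≡-Reasoning

∣[⁅x⁆∪r]∩q∣≡∣[⁅y⁆∪r]∩q∣ : x ∉ r → y ∉ r → (x ∈ q → y ∈ q) → (y ∈ q → x ∈ q) →
                           ∣ (⁅ x ⁆ ∪ r) ∩ q ∣ ≡ ∣ (⁅ y ⁆ ∪ r) ∩ q ∣
∣[⁅x⁆∪r]∩q∣≡∣[⁅y⁆∪r]∩q∣ {x = x} {q = q} x∉r y∉r x∈⇒y∈ y∈⇒x∈ with x ∈? q
... | yes x∈q = trans (∣[⁅x⁆∪p]∩q∣≡1+∣p∩q∣ x∉r x∈q) (sym (∣[⁅x⁆∪p]∩q∣≡1+∣p∩q∣ y∉r (x∈⇒y∈ x∈q)))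
... | no  x∉q = trans (∣[⁅x⁆∪p]∩q∣≡∣p∩q∣ x∉q) (sym (∣[⁅x⁆∪p]∩q∣≡∣p∩q∣ (x∉q ∘ y∈⇒x∈)))

∣p∩q∣≤∣[r∪p]∩q∣ : ∀ (p q r : Subset n) → ∣ p ∩ q ∣ ≤ ∣ (r ∪ p) ∩ q ∣
∣p∩q∣≤∣[r∪p]∩q∣ p q r = p⊆q⇒∣p∣≤∣q∣ λ x∈p∩q →
  let x∈p , x∈q = x∈p∩q⁻ p q x∈p∩q in x∈p∩q⁺ (q⊆p∪q r p x∈p , x∈q)

⊆-ofSize : (p : Subset n) → m ≤ ∣ p ∣ → ∃[ q ] (q ⊆ p × ∣ q ∣ ≡ m)
⊆-ofSize {n} {zero} p _ = ⊥ , ⊆-min p , ∣⊥∣≡0 n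
⊆-ofSize {m = suc m} (outside ∷ p) m<∣p∣ =
  let q , q⊆p , ∣q∣≡1+m = ⊆-ofSize p m<∣p∣ in outside ∷ q , s⊆s q⊆p , ∣q∣≡1+m
⊆-ofSize {m = suc m} (inside ∷ p) (s≤s m≤∣p∣) =
  let q , q⊆p , ∣q∣≡m = ⊆-ofSize p m≤∣p∣ in inside ∷ q , s⊆s q⊆p , cong suc ∣q∣≡m

disjoint-ofSize : (p : Subset n) → m + ∣ p ∣ ≤ n → ∃[ q ] ((∀ {i} → i ∈ p → i ∉ q) × ∣ q ∣ ≡ m)
disjoint-ofSize {n} {m} p m+∣p∣≤n =
  let q , q⊆∁p , ∣q∣≡m = ⊆-ofSize (∁ p) (subst (m ≤_) (sym (∣∁p∣≡n∸∣p∣ p)) (m+n≤o⇒m≤o∸n m m+∣p∣≤n))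
  in q , (λ i∈p i∈q → x∈∁p⇒x∉p (q⊆∁p i∈q) i∈p) , ∣q∣≡m

avoiding-ofSize : ∀ (x y z : Fin n) → x ≢ y → x ≢ z → y ≢ z → m + 3 ≤ n →
                  ∃[ T ] (x ∉ T × y ∉ T × z ∉ T × ∣ T ∣ ≡ m)
avoiding-ofSize {n} {m} x y z x≢y x≢z y≢z m+3≤n =
  let T , S∉T , ∣T∣≡m = disjoint-ofSize S (subst (λ s → m + s ≤ n) (sym ∣S∣≡3) m+3≤n)
  in T , S∉T (p⊆p∪q _ (x∈⁅x⁆ x)) , S∉T (q⊆p∪q _ _ (p⊆p∪q _ (x∈⁅x⁆ y))) ,
     S∉T (q⊆p∪q _ _ (q⊆p∪q _ _ (x∈⁅x⁆ z))) , ∣T∣≡m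
  where
  S : Subset n
  S = ⁅ x ⁆ ∪ (⁅ y ⁆ ∪ ⁅ z ⁆)
  ∣S∣≡3 : ∣ S ∣ ≡ 3
  ∣S∣≡3 = trans (∣⁅x⁆∪p∣≡1+∣p∣ (x≢y∧x∉p⇒x∉⁅y⁆∪p x≢y (x≢z ∘ x∈⁅y⁆⇒x≡y z)))
         (cong suc (trans (∣⁅x⁆∪p∣≡1+∣p∣ (y≢z ∘ x∈⁅y⁆⇒x≡y z)) (cong suc (∣⁅x⁆∣≡1 z))))

splitPair : ∣ p ∣ ≡ 2 + m → x ≢ y → x ∈ p → y ∈ p →
            ∃[ q ] (q ⊆ p × x ∉ q × y ∉ q × ∣ q ∣ ≡ m × p ≡ (⁅ x ⁆ ∪ ⁅ y ⁆) ∪ q)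
splitPair {p = p} {m = m} {x = x} {y = y} ∣p∣≡2+m x≢y x∈p y∈p =
  T , p∩q⊆p p (∁ S) , ∉T (p⊆p∪q _ (x∈⁅x⁆ x)) , ∉T (q⊆p∪q _ _ (x∈⁅x⁆ y)) , ∣T∣≡m , sym p≡S∪T
  where
  S T : Subset _
  S = ⁅ x ⁆ ∪ ⁅ y ⁆
  T = p ∩ ∁ S
  ∉T : ∀ {i} → i ∈ S → i ∉ T
  ∉T i∈S i∈T = x∈∁p⇒x∉p (proj₂ (x∈p∩q⁻ p (∁ S) i∈T)) i∈S
  S⊆p : S ⊆ p
  S⊆p i∈S = [ x∈p⇒⁅x⁆⊆p x∈p , x∈p⇒⁅x⁆⊆p y∈p ]′ (x∈p∪q⁻ ⁅ x ⁆ ⁅ y ⁆ i∈S)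
  p≡S∪T : S ∪ T ≡ p
  p≡S∪T = p⊆q⇒p∪[q∩∁p]≡q S⊆p
  ∣p∣≡2+∣T∣ : ∣ p ∣ ≡ 2 + ∣ T ∣
  ∣p∣≡2+∣T∣ = begin
    ∣ p ∣                   ≡⟨ cong ∣_∣ (trans (sym p≡S∪T) (∪-assoc ⁅ x ⁆ ⁅ y ⁆ T)) ⟩
    ∣ ⁅ x ⁆ ∪ (⁅ y ⁆ ∪ T) ∣ ≡⟨ ∣⁅x⁆∪p∣≡1+∣p∣ (x≢y∧x∉p⇒x∉⁅y⁆∪p x≢y (∉T (p⊆p∪q _ (x∈⁅x⁆ x)))) ⟩
    suc ∣ ⁅ y ⁆ ∪ T ∣       ≡⟨ cong suc (∣⁅x⁆∪p∣≡1+∣p∣ (∉T (q⊆p∪q _ _ (x∈⁅x⁆ y)))) ⟩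
    2 + ∣ T ∣               ∎
    where open ≡-Reasoning
  ∣T∣≡m : ∣ T ∣ ≡ m
  ∣T∣≡m = suc-injective (suc-injective (trans (sym ∣p∣≡2+∣T∣) ∣p∣≡2+m))

InS'-swap : ∀ {k} {x y z : Fin n} {w : JVertex n k} → InS' x y z w → InS' y x z w
InS'-swap w∈S' (T , y∉T , x∉T , z∉T , ∣T∣ , w≡) = w∈S' (T , x∉T , y∉T , z∉T , ∣T∣ , ⊎-swap w≡)

InS'∧z∈∧x∈⇒y∈ : ∀ {x y z : Fin n} (w : JVertex n (2 + m)) → x ≢ z → InS' x y z w →
                 z ∈ proj₁ w → x ∈ proj₁ w → y ∈ proj₁ w
InS'∧z∈∧x∈⇒y∈ {y = y} (W , ∣W∣≡2+m) x≢z w∈S' z∈W x∈W = decidable-stable (y ∈? W) λ y∉W →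
  let T , T⊆W , x∉T , z∉T , ∣T∣≡m , W≡ = splitPair ∣W∣≡2+m x≢z x∈W z∈W
  in w∈S' (T , x∉T , y∉W ∘ T⊆W , z∉T , ∣T∣≡m , inj₁ W≡)

module _ {i j : Fin n} {p : Subset n} (i≢j : i ≢ j) (i∉p : i ∉ p) (j∉p : j ∉ p) (∣p∣≡m : ∣ p ∣ ≡ m) where

  edge : JEdge n (suc m)
  edge = (extend i∉p , extend j∉p) , adjacent
    where
    extend : ∀ {k} → k ∉ p → JVertex n (suc m)
    extend {k} k∉p = ⁅ k ⁆ ∪ p , trans (∣⁅x⁆∪p∣≡1+∣p∣ k∉p) (cong suc ∣p∣≡m)
    adjacent : ∣ (⁅ i ⁆ ∪ p) ∩ (⁅ j ⁆ ∪ p) ∣ ≡ m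
    adjacent = begin
      ∣ (⁅ i ⁆ ∪ p) ∩ (⁅ j ⁆ ∪ p) ∣ ≡⟨ ∣[⁅x⁆∪p]∩q∣≡∣p∩q∣ (x≢y∧x∉p⇒x∉⁅y⁆∪p i≢j i∉p) ⟩
      ∣ p ∩ (⁅ j ⁆ ∪ p) ∣           ≡⟨ cong (λ q → ∣ p ∩ q ∣) (∪-comm ⁅ j ⁆ p) ⟩
      ∣ p ∩ (p ∪ ⁅ j ⁆) ∣           ≡⟨ cong ∣_∣ (∩-abs-∪ p ⁅ j ⁆) ⟩
      ∣ p ∣                         ≡⟨ ∣p∣≡m ⟩
      m                             ∎
      where open ≡-Reasoning

  edist-edge-∉ : (w : JVertex n (suc m)) → j ∉ proj₁ w → edist edge w ≡ suc m ∸ ∣ (⁅ i ⁆ ∪ p) ∩ proj₁ w ∣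
  edist-edge-∉ (W , _) j∉W = m≤n⇒m⊓n≡m (∸-monoʳ-≤ (suc m) ∣j∪p∩W∣≤∣i∪p∩W∣)
    where
    open ≤-Reasoning
    ∣j∪p∩W∣≤∣i∪p∩W∣ : ∣ (⁅ j ⁆ ∪ p) ∩ W ∣ ≤ ∣ (⁅ i ⁆ ∪ p) ∩ W ∣
    ∣j∪p∩W∣≤∣i∪p∩W∣ = begin
      ∣ (⁅ j ⁆ ∪ p) ∩ W ∣ ≡⟨ ∣[⁅x⁆∪p]∩q∣≡∣p∩q∣ j∉W ⟩
      ∣ p ∩ W ∣           ≤⟨ ∣p∩q∣≤∣[r∪p]∩q∣ p W ⁅ i ⁆ ⟩
      ∣ (⁅ i ⁆ ∪ p) ∩ W ∣ ∎

module EdgePair {x y z : Fin n} {T : Subset n} (x≢y : x ≢ y) (x≢z : x ≢ z) (y≢z : y ≢ z)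
                (x∉T : x ∉ T) (y∉T : y ∉ T) (z∉T : z ∉ T) (∣T∣≡m : ∣ T ∣ ≡ m) where

  private
    A B C : Subset n
    A = ⁅ x ⁆ ∪ (⁅ y ⁆ ∪ T)
    B = ⁅ z ⁆ ∪ (⁅ x ⁆ ∪ T)
    C = ⁅ z ⁆ ∪ (⁅ y ⁆ ∪ T)

    ⁅y⁆∪⁅x⁆∪T≡A : ⁅ y ⁆ ∪ (⁅ x ⁆ ∪ T) ≡ A
    ⁅y⁆∪⁅x⁆∪T≡A = ⁅x⁆∪[⁅y⁆∪p]≡⁅y⁆∪[⁅x⁆∪p] y x T

    ∣⁅_⁆∪T∣ : ∀ {i} → i ∉ T → ∣ ⁅ i ⁆ ∪ T ∣ ≡ suc m
    ∣⁅ i∉T ⁆∪T∣ = trans (∣⁅x⁆∪p∣≡1+∣p∣ i∉T) (cong suc ∣T∣≡m)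

    x∉⁅y⁆∪T : x ∉ ⁅ y ⁆ ∪ T
    x∉⁅y⁆∪T = x≢y∧x∉p⇒x∉⁅y⁆∪p x≢y x∉T
    y∉⁅x⁆∪T : y ∉ ⁅ x ⁆ ∪ T
    y∉⁅x⁆∪T = x≢y∧x∉p⇒x∉⁅y⁆∪p (x≢y ∘ sym) y∉T
    z∉⁅x⁆∪T : z ∉ ⁅ x ⁆ ∪ T
    z∉⁅x⁆∪T = x≢y∧x∉p⇒x∉⁅y⁆∪p (x≢z ∘ sym) z∉T
    z∉⁅y⁆∪T : z ∉ ⁅ y ⁆ ∪ T
    z∉⁅y⁆∪T = x≢y∧x∉p⇒x∉⁅y⁆∪p (y≢z ∘ sym) z∉T
    x∉C : x ∉ C
    x∉C = x≢y∧x∉p⇒x∉⁅y⁆∪p x≢z x∉⁅y⁆∪T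

    x∈⁅_⁆∪⁅x⁆∪T : ∀ i → x ∈ ⁅ i ⁆ ∪ (⁅ x ⁆ ∪ T)
    x∈⁅ i ⁆∪⁅x⁆∪T = q⊆p∪q ⁅ i ⁆ _ (p⊆p∪q T (x∈⁅x⁆ x))

  e₁ e₂ : JEdge n (2 + m)
  e₁ = edge y≢z y∉⁅x⁆∪T z∉⁅x⁆∪T ∣⁅ x∉T ⁆∪T∣
  e₂ = edge x≢z x∉⁅y⁆∪T z∉⁅y⁆∪T ∣⁅ y∉T ⁆∪T∣

  e₁≉e₂ : ¬ SameEdge e₁ e₂
  e₁≉e₂ (inj₁ (_ , B≡C)) = x∉C (subst (x ∈_) B≡C x∈⁅ z ⁆∪⁅x⁆∪T)
  e₁≉e₂ (inj₂ (A≡C , _)) = x∉C (subst (x ∈_) A≡C x∈⁅ y ⁆∪⁅x⁆∪T)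

  edist-e₁≡edist-e₂ : (w : JVertex n (2 + m)) → InS' x y z w → edist e₁ w ≡ edist e₂ w
  edist-e₁≡edist-e₂ w@(W , _) w∈S' with z ∈? W
  ... | yes z∈W = cong₂ (λ a b → (2 + m ∸ a) ⊓ (2 + m ∸ b)) (cong (λ D → ∣ D ∩ W ∣) ⁅y⁆∪⁅x⁆∪T≡A) ∣B∩W∣≡∣C∩W∣
    where
    open ≡-Reasoning
    ∣B∩W∣≡∣C∩W∣ : ∣ B ∩ W ∣ ≡ ∣ C ∩ W ∣
    ∣B∩W∣≡∣C∩W∣ = begin
      ∣ B ∩ W ∣               ≡⟨ ∣[⁅x⁆∪p]∩q∣≡1+∣p∩q∣ z∉⁅x⁆∪T z∈W ⟩
      suc ∣ (⁅ x ⁆ ∪ T) ∩ W ∣ ≡⟨ cong suc (∣[⁅x⁆∪r]∩q∣≡∣[⁅y⁆∪r]∩q∣ x∉T y∉T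
                                   (InS'∧z∈∧x∈⇒y∈ w x≢z w∈S' z∈W)
                                   (InS'∧z∈∧x∈⇒y∈ w y≢z (InS'-swap {w = w} w∈S') z∈W)) ⟩
      suc ∣ (⁅ y ⁆ ∪ T) ∩ W ∣ ≡⟨ sym (∣[⁅x⁆∪p]∩q∣≡1+∣p∩q∣ z∉⁅y⁆∪T z∈W) ⟩
      ∣ C ∩ W ∣               ∎
  ... | no z∉W = begin
    edist e₁ w                            ≡⟨ edist-edge-∉ y≢z y∉⁅x⁆∪T z∉⁅x⁆∪T ∣⁅ x∉T ⁆∪T∣ w z∉W ⟩
    2 + m ∸ ∣ (⁅ y ⁆ ∪ (⁅ x ⁆ ∪ T)) ∩ W ∣ ≡⟨ cong (λ D → 2 + m ∸ ∣ D ∩ W ∣) ⁅y⁆∪⁅x⁆∪T≡A ⟩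
    2 + m ∸ ∣ A ∩ W ∣                     ≡⟨ sym (edist-edge-∉ x≢z x∉⁅y⁆∪T z∉⁅y⁆∪T ∣⁅ y∉T ⁆∪T∣ w z∉W) ⟩
    edist e₂ w                            ∎
    where open ≡-Reasoning

m+3≤2*[2+m] : ∀ m → m + 3 ≤ 2 * (2 + m)
m+3≤2*[2+m] m = subst (m + 3 ≤_) (sym (2*[2+m]≡m+3+[1+m] m)) (m≤m+n (m + 3) (suc m))
  where
  2*[2+m]≡m+3+[1+m] : ∀ m → 2 * (2 + m) ≡ (m + 3) + suc m
  2*[2+m]≡m+3+[1+m] = solve-∀

lemma2 : (n k : ℕ) → 2 ≤ k → 2 * k ≤ n →
    (x y z : Fin n) → x ≢ y → x ≢ z → y ≢ z →
    ¬ IsEdgeResolving {n} {k} (InS' x y z)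
lemma2 n (suc (suc m)) (s≤s (s≤s _)) 2k≤n x y z x≢y x≢z y≢z resolving =
  let T , x∉T , y∉T , z∉T , ∣T∣≡m = avoiding-ofSize x y z x≢y x≢z y≢z (≤-trans (m+3≤2*[2+m] m) 2k≤n)
      open EdgePair x≢y x≢z y≢z x∉T y∉T z∉T ∣T∣≡m
      w , w∈S' , e₁w≢e₂w = resolving e₁ e₂ e₁≉e₂
  in e₁w≢e₂w (edist-e₁≡edist-e₂ w w∈S')
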